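{- SESs and EBESs are incomparable: there exists an SES $\sigma$ such that no EBES has the same set of posets as $\sigma$, and there exists an EBES $\xi$ such that no SES has the same set of posets as $\xi$.
   Context: An SES is a tuple $\sigma=(E,\#,\to,\mathrm{Drop})$: $E$ a set of events, $\#\subseteq E^2$ irreflexive and symmetric, $\to\subseteq E^2$, $\mathrm{Drop}\subseteq E^3$ with $(d,c,t)\in\mathrm{Drop}$ implying $c\to t$ and $d\notin\{c,t\}$. Let $\mathrm{ic}(e)=\{e'\mid e'\to e\}$, $\mathrm{dc}(H,e)=\{e'\mid\exists d\in H.(d,e',e)\in\mathrm{Drop}\}$. For $t=e_1\cdots e_n$, $\overline t=\{e_1,\dots,e_n\}$, $t_i=e_1\cdots e_i$. A trace of $\sigma$ is a sequence of pairwise distinct, pairwise non-conflicting events with $\mathrm{ic}(e_i)\setminus\mathrm{dc}(\overline{t_{i-1}},e_i)\subseteq\overline{t_{i-1}}$ for all $i$. For a trace and sets $U_1\ne U_2$ of its events, $U_1$ is earlier than $U_2$ if the largest index $j$ with $e_j\in U_1\setminus U_2$ is smaller than the largest index $j$ with $e_j\in U_2\setminus U_1$. The cause $U_i$ of $e_i$ in $t$ is the earliest $U\subseteq\overline{t_{i-1}}$ with $\mathrm{ic}(e_i)\setminus\mathrm{dc}(U,e_i)\subseteq U$; the poset of $t$ is $(\overline t,\le)$ with $\le$ the reflexive transitive closure of $\{(c,e_i)\mid c\in U_i\}$; the posets of $\sigma$ are the posets of all its traces. An Extended Bundle Event Structure (EBES) is $\xi=(E,\rightsquigarrow,\mapsto)$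 with $E$ a set of events, $\rightsquigarrow\subseteq E^2$ irreflexive (disabling: $e\rightsquigarrow e'$ means $e'$ disables $e$), and $\mapsto\subseteq\mathcal P(E)\times E$ (bundles) such that $X\mapsto e$ implies $e_1\rightsquigarrow e_2$ for all distinct $e_1,e_2\in X$. A trace of $\xi$ is a sequence $e_1\cdots e_n$ of pairwise distinct events such that $e_i\rightsquigarrow e_j$ implies $i<j$, and every bundle $X\mapsto e_i$ satisfies $X\cap\overline{t_{i-1}}\ne\emptyset$. Configurations are the sets $\overline t$ of traces $t$. For a configuration $C$ and $e,e'\in C$, $e\prec_C e'$ iff $e\rightsquigarrow e'$ or $e\in X$ for some bundle $X\mapsto e'$; $\le_C$ is the reflexive transitive closure of $\prec_C$, and the set of posets of $\xi$ is $\{(C,\le_C)\mid C \text{ a configuration}\}$. -}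

module Defs where

open import Data.Nat using (ℕ; _<_)
open import Data.Fin using (Fin; toℕ)
open import Data.List using (List; length; lookup; take)
open import Data.List.Membership.Propositional using (_∈_; _∉_)
open import Data.List.Relation.Unary.Unique.Propositional using (Unique)
open import Data.Product using (Σ; ∃; ∃-syntax; _×_)
open import Data.Empty using (⊥)
open import Data.Sum using (_⊎_)
open import Relation.Nullary using (¬_)
open import Relation.Binary.PropositionalEquality using (_≡_; _≢_)
open import Relation.Binary.Construct.Closure.ReflexiveTransitive using (Star)
open import Function.Bundles using (_⇔_)

-- Events are drawn from a fixed universe ℕ; each structure carries its
-- event set E as a predicate on ℕ.  Traces are finite lists of events.

-- e_i (0-based position i)
ev : (t : List ℕ) → Fin (length t) → ℕ
ev t i = lookup t i

-- t_{i-1} in the paper's 1-based notation: the events strictly before position i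
pre : (t : List ℕ) → Fin (length t) → List ℕ
pre t i = take (toℕ i) t

record Poset : Set₁ where
  field
    Carrier : ℕ → Set
    Ord     : ℕ → ℕ → Set

open Poset public

_≈P_ : Poset → Poset → Set
P ≈P Q = (∀ x → Carrier P x ⇔ Carrier Q x)
       × (∀ x y → Carrier P x → Carrier P y → Ord P x y ⇔ Ord Q x y)

record SES : Set₁ where
  field
    E    : ℕ → Set
    _#_  : ℕ → ℕ → Set
    _⟶_  : ℕ → ℕ → Set
    Drop : ℕ → ℕ → ℕ → Set
    #-⊆      : ∀ {x y} → x # y → E x × E y
    #-irrefl : ∀ {x} → ¬ (x # x)
    #-sym    : ∀ {x y} → x # y → y # x
    ⟶-⊆      : ∀ {x y} → x ⟶ y → E x × E y
    Drop-⊆   : ∀ {d c t} → Drop d c t → E d × E c × E t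
    Drop-⟶   : ∀ {d c t} → Drop d c t → c ⟶ t
    Drop-≢c  : ∀ {d c t} → Drop d c t → d ≢ c
    Drop-≢t  : ∀ {d c t} → Drop d c t → d ≢ t

module _ (σ : SES) where
  open SES σ

  InDC : List ℕ → ℕ → ℕ → Set
  InDC H e e' = ∃[ d ] (d ∈ H × Drop d e' e)

  Enables : List ℕ → ℕ → Set
  Enables U e = ∀ e' → e' ⟶ e → ¬ InDC U e e' → e' ∈ U

  record SESTrace (t : List ℕ) : Set where
    field
      distinct  : Unique t
      inE       : ∀ {x} → x ∈ t → E x
      conflictF : ∀ {x y} → x ∈ t → y ∈ t → ¬ (x # y)
      enabled   : ∀ (i : Fin (length t)) → Enables (pre t i) (ev t i)

  -- U₁ is earlier than U₂ in t (for U₁ ≠ U₂): the largest index of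
  -- U₁ \ U₂ is smaller than the largest index of U₂ \ U₁ (an empty
  -- difference has no largest index and counts as -∞).
  Earlier : List ℕ → List ℕ → List ℕ → Set
  Earlier t U₁ U₂ =
    ∃[ j ] (ev t j ∈ U₂ × ev t j ∉ U₁
           × (∀ k → toℕ j < toℕ k → ev t k ∈ U₁ → ev t k ∈ U₂))

  SameSet : List ℕ → List ℕ → Set
  SameSet U V = ∀ x → (x ∈ U ⇔ x ∈ V)

  IsCause : (t : List ℕ) → Fin (length t) → List ℕ → Set
  IsCause t i U =
      (∀ {x} → x ∈ U → x ∈ pre t i)
    × Enables U (ev t i)
    × (∀ V → (∀ {x} → x ∈ V → x ∈ pre t i) → Enables V (ev t i)
           → ¬ SameSet U V → Earlier t U V)

  CauseStep : List ℕ → ℕ → ℕ → Set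
  CauseStep t c e = ∃[ i ] (e ≡ ev t i × ∃[ U ] (IsCause t i U × c ∈ U))

  posetSES : List ℕ → Poset
  posetSES t = record { Carrier = λ x → x ∈ t ; Ord = Star (CauseStep t) }

record EBES : Set₁ where
  field
    E      : ℕ → Set
    _⇝_    : ℕ → ℕ → Set
    -- the bundle relation ↦ ⊆ P(E) × E, given as a family of pairs (X_b , e_b)
    Bundle    : Set
    bset      : Bundle → ℕ → Set
    btarget   : Bundle → ℕ
    ⇝-⊆       : ∀ {x y} → x ⇝ y → E x × E y
    ⇝-irrefl  : ∀ {x} → ¬ (x ⇝ x)
    bundle-⊆  : ∀ b → (∀ {x} → bset b x → E x) × E (btarget b)
    bundle-stable : ∀ b {e₁ e₂} → bset b e₁ → bset b e₂ → e₁ ≢ e₂ → e₁ ⇝ e₂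

module _ (ξ : EBES) where
  open EBES ξ

  record EBESTrace (t : List ℕ) : Set where
    field
      distinct  : Unique t
      inE       : ∀ {x} → x ∈ t → E x
      disabling : ∀ (i j : Fin (length t)) → ev t i ⇝ ev t j → toℕ i < toℕ j
      bundles   : ∀ (i : Fin (length t)) (b : Bundle) → btarget b ≡ ev t i
                  → ∃[ x ] (bset b x × x ∈ pre t i)

  Prec : List ℕ → ℕ → ℕ → Set
  Prec C e e' = e ∈ C × e' ∈ C
              × (e ⇝ e' ⊎ ∃[ b ] (btarget b ≡ e' × bset b e))

  posetEBES : List ℕ → Poset
  posetEBES C = record { Carrier = λ x → x ∈ C ; Ord = Star (Prec C) }

SamePosets : SES → EBES → Set
SamePosets σ ξ =
    (∀ t → SESTrace σ t → ∃[ t' ] (EBESTrace ξ t' × posetSES σ t ≈P posetEBES ξ t'))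
  × (∀ t' → EBESTrace ξ t' → ∃[ t ] (SESTrace σ t × posetEBES ξ t' ≈P posetSES σ t))

-- Dropped causality is non-monotone: in the SES with 0 → 2 and Drop(1,0,2), the event 1 precedes 2
-- in the trace 1·2 (it dropped the cause 0), but not in 0·1·2, where 0 itself causes 2. In an EBES
-- both ⇝ and bundles are fixed relations merely restricted to the configuration, so the order of a
-- configuration persists in every larger one; hence no EBES has the posets of this SES.
-- Conversely, the EBES with 0 ⇝ 1 has the configurations {1} and {0,1} with 0 < 1 in the latter.
-- In an SES an event that can occur first has no initial causes, so its cause in every trace is
-- empty and no other event ever precedes it; hence no SES has the posets of this EBES.
module Submission where

open import Defs
open import Data.Product using (Σ; _×_; _,_)
open import Data.Sum using (_⊎_; inj₁; inj₂)
open import Data.Empty using (⊥; ⊥-elim)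
open import Data.Unit using (⊤; tt)
open import Data.Nat using (ℕ; s≤s; z≤n)
open import Data.Fin using (toℕ) renaming (zero to fz; suc to fs)
open import Data.List using (List; []; _∷_; lookup; take)
open import Data.List.Membership.Propositional using (_∈_; _∉_)
open import Data.List.Membership.Propositional.Properties using (∈-lookup)
open import Data.List.Relation.Binary.Subset.Propositional using (_⊆_)
open import Data.List.Relation.Binary.Sublist.Propositional.Properties using (Any-resp-⊆; take-⊆)
open import Data.List.Relation.Unary.Any using (here; there; index)
open import Data.List.Relation.Unary.Any.Properties using (lookup-index)
open import Data.List.Relation.Unary.All using ([]; _∷_)
import Data.List.Relation.Unary.All as All
open import Data.List.Relation.Unary.AllPairs.Core using ([]; _∷_)
open import Data.List.Relation.Unary.Unique.Propositional using (Unique)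
open import Relation.Nullary using (¬_)
open import Relation.Binary.PropositionalEquality using (_≡_; refl; sym; trans)
open import Relation.Binary.Construct.Closure.ReflexiveTransitive using (Star; ε; _◅_; fold; map)
open import Function.Base using (_∘_; id)
open import Function.Bundles using (mk⇔; Equivalence)
open Equivalence using (to; from)

Star-backward-closed : {R : ℕ → ℕ → Set} (P : ℕ → Set) → (∀ {x y} → R x y → P y → P x)
                     → ∀ {x y} → Star R x y → P y → P x
Star-backward-closed P closed = fold (λ x y → P y → P x) (λ r k → closed r ∘ k) id

∈-pre⇒∈ : ∀ t i → pre t i ⊆ t
∈-pre⇒∈ t i = Any-resp-⊆ (take-⊆ (toℕ i) t)

lookup∉take : ∀ {xs : List ℕ} → Unique xs → ∀ i → lookup xs i ∉ take (toℕ i) xs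
lookup∉take {_ ∷ xs} (x∉xs ∷ _)   (fs i) (here eq) = All.lookup x∉xs (∈-lookup i) (sym eq)
lookup∉take {_ ∷ _}  (_ ∷ unique) (fs i) (there p) = lookup∉take unique i p

posetEBES-mono : ∀ (ξ : EBES) {C D} → C ⊆ D → ∀ {x y} → Star (Prec ξ C) x y → Star (Prec ξ D) x y
posetEBES-mono ξ C⊆D = map λ (x∈C , y∈C , step) → C⊆D x∈C , C⊆D y∈C , step

SamePosets⇒posetSES-mono : ∀ σ ξ → SamePosets σ ξ → ∀ {t t'} → SESTrace σ t → SESTrace σ t' → t ⊆ t'
                         → ∀ {x y} → x ∈ t → y ∈ t → Ord (posetSES σ t) x y → Ord (posetSES σ t') x y
SamePosets⇒posetSES-mono σ ξ (toEBES , _) {t} {t'} tr tr' t⊆t' {x} {y} x∈t y∈t x≤y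
  with toEBES t tr | toEBES t' tr'
... | C , _ , sameC , ordC | D , _ , sameD , ordD =
  from (ordD x y (t⊆t' x∈t) (t⊆t' y∈t))
    (posetEBES-mono ξ C⊆D (to (ordC x y x∈t y∈t) x≤y))
  where
  C⊆D : C ⊆ D
  C⊆D {z} = to (sameD z) ∘ t⊆t' ∘ from (sameC z)

module _ (σ : SES) where
  open SES σ

  Initial : ℕ → Set
  Initial e = ∀ e' → ¬ (e' ⟶ e)

  -- The empty set enables an initial event, and no U ≠ ∅ is earlier than ∅.
  IsCause-of-initial : ∀ {t i U} → Initial (ev t i) → IsCause σ t i U → ∀ {c} → c ∉ U
  IsCause-of-initial {U = U} initial (_ , _ , earliest) c∈U
    with earliest [] (λ ()) (λ e' e'⟶e _ → ⊥-elim (initial e' e'⟶e)) U≉∅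
    where
    U≉∅ : ¬ SameSet σ U []
    U≉∅ U≈∅ with to (U≈∅ _) c∈U
    ... | ()
  ... | _ , () , _

  CauseStep-into-initial : ∀ {t c e} → Initial e → ¬ CauseStep σ t c e
  CauseStep-into-initial initial (i , refl , U , cause , c∈U) = IsCause-of-initial initial cause c∈U

  initial-minimal : ∀ {t c e} → Initial e → Star (CauseStep σ t) c e → c ≡ e
  initial-minimal {e = e} initial c≤e =
    Star-backward-closed (_≡ e) (λ { step refl → ⊥-elim (CauseStep-into-initial initial step) }) c≤e refl

  -- If e is the only event of a trace, nothing precedes e there, so nothing can have enabled it.
  sole-event-initial : ∀ {t e} → SESTrace σ t → e ∈ t → (∀ {x} → x ∈ t → x ≡ e) → Initial e
  sole-event-initial {t} tr e∈t sole e' e'⟶e = pre-empty (SESTrace.enabled tr i e' e'⟶ei noDrop)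
    where
    i = index e∈t
    e≡ei = lookup-index e∈t
    e'⟶ei : e' ⟶ ev t i
    e'⟶ei rewrite sym e≡ei = e'⟶e
    pre-empty : ∀ {x} → x ∉ pre t i
    pre-empty x∈pre with trans (sole (∈-pre⇒∈ t i x∈pre)) e≡ei
    ... | refl = lookup∉take (SESTrace.distinct tr) i x∈pre
    noDrop : ¬ InDC σ (pre t i) (ev t i) e'
    noDrop (_ , d∈pre , _) = pre-empty d∈pre

droppingSES : SES
droppingSES = record
  { E = λ _ → ⊤
  ; _#_ = λ _ _ → ⊥
  ; _⟶_ = λ x y → x ≡ 0 × y ≡ 2
  ; Drop = λ d c t → d ≡ 1 × c ≡ 0 × t ≡ 2
  ; #-⊆ = λ ()
  ; #-irrefl = λ ()
  ; #-sym = λ ()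
  ; ⟶-⊆ = λ _ → tt , tt
  ; Drop-⊆ = λ _ → tt , tt , tt
  ; Drop-⟶ = λ { (refl , refl , refl) → refl , refl }
  ; Drop-≢c = λ { (refl , refl , refl) () }
  ; Drop-≢t = λ { (refl , refl , refl) () }
  }

1∷2 : List ℕ
1∷2 = 1 ∷ 2 ∷ []

0∷1∷2 : List ℕ
0∷1∷2 = 0 ∷ 1 ∷ 2 ∷ []

1-enables-2 : Enables droppingSES (1 ∷ []) 2
1-enables-2 _ (refl , refl) notDropped = ⊥-elim (notDropped (1 , here refl , refl , refl , refl))

0-enables-2 : ∀ {xs} → Enables droppingSES (0 ∷ xs) 2
0-enables-2 _ (refl , refl) _ = here refl

0-initial : Initial droppingSES 0
0-initial _ (_ , ())

trace-1∷2 : SESTrace droppingSES 1∷2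
trace-1∷2 = record
  { distinct = ((λ ()) ∷ []) ∷ [] ∷ []
  ; inE = λ _ → tt
  ; conflictF = λ _ _ ()
  ; enabled = λ { fz _ (_ , ()) ; (fs fz) → 1-enables-2 }
  }

trace-0∷1∷2 : SESTrace droppingSES 0∷1∷2
trace-0∷1∷2 = record
  { distinct = ((λ ()) ∷ (λ ()) ∷ []) ∷ ((λ ()) ∷ []) ∷ [] ∷ []
  ; inE = λ _ → tt
  ; conflictF = λ _ _ ()
  ; enabled = λ { fz _ (_ , ()) ; (fs fz) _ (_ , ()) ; (fs (fs fz)) → 0-enables-2 }
  }

-- Every V ⊆ {1} enabling 2 must drop 0, so contains 1.
1-causes-2-in-1∷2 : IsCause droppingSES 1∷2 (fs fz) (1 ∷ [])
1-causes-2-in-1∷2 = id , 1-enables-2 , earliest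
  where
  earliest : ∀ V → V ⊆ 1 ∷ [] → Enables droppingSES V 2
           → ¬ SameSet droppingSES (1 ∷ []) V → Earlier droppingSES 1∷2 (1 ∷ []) V
  earliest V V⊆1 enables 1≉V with V⊆1 (enables 0 (refl , refl) 0-not-dropped)
    where
    0-not-dropped : ¬ InDC droppingSES V 2 0
    0-not-dropped (_ , 1∈V , refl , _) = 1≉V λ _ → mk⇔ (λ { (here refl) → 1∈V }) V⊆1
  ... | here ()
  ... | there ()

1≤2-in-1∷2 : Ord (posetSES droppingSES 1∷2) 1 2
1≤2-in-1∷2 = (fs fz , refl , _ , 1-causes-2-in-1∷2 , here refl) ◅ ε

-- A cause U ∋ 1 of 2 differs from {0}, yet is not earlier than {0}: 1 occurs after 0.
causes-of-2-in-0∷1∷2 : ∀ {c} → CauseStep droppingSES 0∷1∷2 c 2 → c ≡ 0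
causes-of-2-in-0∷1∷2 (fz , () , _)
causes-of-2-in-0∷1∷2 (fs fz , () , _)
causes-of-2-in-0∷1∷2 (fs (fs fz) , refl , U , (U⊆01 , _ , earliest) , c∈U) with U⊆01 c∈U
... | here c≡0 = c≡0
... | there (there ())
... | there (here refl) = ⊥-elim (not-earlier (earliest (0 ∷ []) 0⊆01 0-enables-2 U≉0))
  where
  0⊆01 : 0 ∷ [] ⊆ 0 ∷ 1 ∷ []
  0⊆01 (here refl) = here refl
  U≉0 : ¬ SameSet droppingSES U (0 ∷ [])
  U≉0 U≈0 with to (U≈0 1) c∈U
  ... | here ()
  ... | there ()
  not-earlier : ¬ Earlier droppingSES 0∷1∷2 U (0 ∷ [])
  not-earlier (fz , _ , _ , later-in-0) with later-in-0 (fs fz) (s≤s z≤n) c∈U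
  ... | here ()
  ... | there ()
  not-earlier (fs fz , here () , _)
  not-earlier (fs fz , there () , _)
  not-earlier (fs (fs fz) , here () , _)
  not-earlier (fs (fs fz) , there () , _)

1≰2-in-0∷1∷2 : ¬ Ord (posetSES droppingSES 0∷1∷2) 1 2
1≰2-in-0∷1∷2 1≤2 with Star-backward-closed (λ x → x ≡ 0 ⊎ x ≡ 2) below-2 1≤2 (inj₂ refl)
  where
  below-2 : ∀ {x y} → CauseStep droppingSES 0∷1∷2 x y → y ≡ 0 ⊎ y ≡ 2 → x ≡ 0 ⊎ x ≡ 2
  below-2 step (inj₁ refl) = ⊥-elim (CauseStep-into-initial droppingSES 0-initial step)
  below-2 step (inj₂ refl) = inj₁ (causes-of-2-in-0∷1∷2 step)
... | inj₁ ()
... | inj₂ ()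

droppingSES-not-EBES : ∀ (ξ : EBES) → ¬ SamePosets droppingSES ξ
droppingSES-not-EBES ξ same =
  1≰2-in-0∷1∷2 (SamePosets⇒posetSES-mono droppingSES ξ same trace-1∷2 trace-0∷1∷2 there
                  (here refl) (there (here refl)) 1≤2-in-1∷2)

disablingEBES : EBES
disablingEBES = record
  { E = λ _ → ⊤
  ; _⇝_ = λ x y → x ≡ 0 × y ≡ 1
  ; Bundle = ⊥
  ; bset = λ ()
  ; btarget = λ ()
  ; ⇝-⊆ = λ _ → tt , tt
  ; ⇝-irrefl = λ { (refl , ()) }
  ; bundle-⊆ = λ ()
  ; bundle-stable = λ ()
  }

trace-1 : EBESTrace disablingEBES (1 ∷ [])
trace-1 = record
  { distinct = [] ∷ []
  ; inE = λ _ → tt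
  ; disabling = λ { fz fz (() , _) }
  ; bundles = λ _ ()
  }

trace-0∷1 : EBESTrace disablingEBES (0 ∷ 1 ∷ [])
trace-0∷1 = record
  { distinct = ((λ ()) ∷ []) ∷ [] ∷ []
  ; inE = λ _ → tt
  ; disabling = λ { fz fz (_ , ()) ; fz (fs fz) _ → s≤s z≤n ; (fs fz) _ (() , _) }
  ; bundles = λ _ ()
  }

disablingEBES-not-SES : ∀ (σ : SES) → ¬ SamePosets σ disablingEBES
disablingEBES-not-SES σ (_ , toSES) with toSES (1 ∷ []) trace-1 | toSES (0 ∷ 1 ∷ []) trace-0∷1
... | t₁ , tr₁ , same₁ , _ | t , _ , _ , ord with initial-minimal σ 1-initial 0≤1
  where
  only-1 : ∀ {x} → x ∈ t₁ → x ≡ 1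
  only-1 {x} x∈t₁ with from (same₁ x) x∈t₁
  ... | here x≡1 = x≡1
  1-initial : Initial σ 1
  1-initial = sole-event-initial σ tr₁ (to (same₁ 1) (here refl)) only-1
  0≤1 : Ord (posetSES σ t) 0 1
  0≤1 = to (ord 0 1 (here refl) (there (here refl))) ((here refl , there (here refl) , inj₁ (refl , refl)) ◅ ε)
... | ()

theorem4p17 : (Σ SES λ σ → ∀ (ξ : EBES) → ¬ SamePosets σ ξ)
            × (Σ EBES λ ξ → ∀ (σ : SES) → ¬ SamePosets σ ξ)
theorem4p17 = (droppingSES , droppingSES-not-EBES) , (disablingEBES , disablingEBES-not-SES)
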